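{- Let $G$ be a finite simple graph and $k > \Gamma(G)$ an integer. If $D_k(G)$ is connected, then $D_{k+1}(G)$ is connected.
   Context: A set $S \subseteq V(G)$ is a dominating set of $G$ if every vertex of $V(G)\setminus S$ is adjacent to a vertex of $S$; it is a minimal dominating set if no proper subset is a dominating set. $\Gamma(G)$ is the maximum cardinality of a minimal dominating set of $G$. For an integer $k$ at least the minimum cardinality of a dominating set of $G$, the $k$-dominating graph $D_k(G)$ is the graph whose vertices are the dominating sets of $G$ of cardinality at most $k$, two such sets $A,B$ being adjacent if and only if their symmetric difference $(A\setminus B)\cup(B\setminus A)$ consists of exactly one vertex of $G$. -}

module Defs where

open import Data.Nat using (ℕ; _≤_)
open import Data.Bool using (Bool; true; false)
open import Data.Fin using (Fin)
open import Data.Fin.Subset using (Subset; _∈_; _⊂_; ∣_∣)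
open import Data.Vec using (lookup)
open import Data.Product using (Σ; ∃; _×_; _,_)
open import Data.Sum using (_⊎_)
open import Relation.Nullary using (¬_)
open import Relation.Binary.PropositionalEquality using (_≡_; _≢_)

record Graph (n : ℕ) : Set where
  field
    adj   : Fin n → Fin n → Bool
    sym   : ∀ u v → adj u v ≡ adj v u
    irrefl : ∀ v → adj v v ≡ false
open Graph public

module _ {n : ℕ} (G : Graph n) where

  Dominating : Subset n → Set
  Dominating S = ∀ v → v ∈ S ⊎ (∃ λ u → u ∈ S × adj G u v ≡ true)

  MinimalDominating : Subset n → Set
  MinimalDominating S = Dominating S × (∀ T → T ⊂ S → ¬ Dominating T)

  IsUpperDomination : ℕ → Set
  IsUpperDomination m =
    (∃ λ S → MinimalDominating S × ∣ S ∣ ≡ m) × (∀ S → MinimalDominating S → ∣ S ∣ ≤ m)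

  -- vertices of D_k(G): dominating sets of cardinality at most k
  InD : ℕ → Subset n → Set
  InD k S = Dominating S × ∣ S ∣ ≤ k

  DiffByOne : Subset n → Subset n → Set
  DiffByOne A B = ∃ λ v → (lookup A v ≢ lookup B v) × (∀ w → w ≢ v → lookup A w ≡ lookup B w)

  -- walks in D_k(G) (every vertex after the start lies in D_k(G))
  data Walk (k : ℕ) : Subset n → Subset n → Set where
    done : ∀ {A} → Walk k A A
    step : ∀ {A B C} → InD k B → DiffByOne A B → Walk k B C → Walk k A C

  Connected-D : ℕ → Set
  Connected-D k = ∀ A B → InD k A → InD k B → Walk k A B

module Submission where

-- Fix k > Γ(G).  Every dominating set X with ∣X∣ = k + 1 has
-- more than Γ(G) elements, so it is not a minimal dominating set; since
-- domination is monotone under inclusion, this means some single vertex v ∈ X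
-- is redundant, i.e. X - v is still dominating.  Thus every vertex of D_{k+1}(G)
-- is either already in D_k(G) or adjacent (in both directions) to one.  Given
-- A, B in D_{k+1}(G), we descend to A', B' in D_k(G), join them by a walk in
-- D_k(G) (connectedness hypothesis), lift that walk to D_{k+1}(G), and
-- concatenate.

open import Defs
open import Data.Nat using (ℕ; suc; _≤_; _<_; _≤?_)
open import Data.Nat.Properties using (≤-pred; <-≤-trans; <-trans; m≤n⇒m≤1+n; ≰⇒>; <⇒≱)
open import Data.Bool using (true; false)
import Data.Bool.Properties as Bool
open import Data.Fin using (Fin; zero; suc)
open import Data.Fin.Subset using (Subset; _∈_; _∉_; _⊆_; _⊂_; _-_; ⁅_⁆; ∣_∣)
open import Data.Fin.Subset.Properties
  using (_∈?_; x∈p∧x≢y⇒x∈p-y; p─q⊆p; x∈p⇒∣p-x∣<∣p∣)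
open import Data.Fin.Properties using (any?; all?)
open import Data.Vec using (_∷_; lookup; there)
open import Data.Vec.Properties using ([]=⇒lookup; lookup⇒[]=)
open import Data.Product using (∃; _×_; _,_; proj₁; proj₂)
open import Data.Sum using (inj₁; inj₂)
open import Relation.Nullary using (¬_; Dec; yes; no; contradiction)
open import Relation.Nullary.Decidable using (_⊎-dec_; _×-dec_)
open import Relation.Binary.PropositionalEquality using (_≡_; _≢_; refl; trans)
  renaming (sym to ≡-sym)

x∉p-x : ∀ {n} (p : Subset n) (x : Fin n) → x ∉ p - x
x∉p-x (_ ∷ p) zero    ()
x∉p-x (_ ∷ p) (suc x) (there x∈p-x) = x∉p-x p x x∈p-x

lookup-≡ : ∀ {n} (p q : Subset n) w → (w ∈ p → w ∈ q) → (w ∈ q → w ∈ p) →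
           lookup p w ≡ lookup q w
lookup-≡ p q w p⇒q q⇒p with lookup p w in eqp | lookup q w in eqq
... | true  | true  = refl
... | false | false = refl
... | true  | false = contradiction (trans (≡-sym ([]=⇒lookup (p⇒q (lookup⇒[]= w p eqp)))) eqq) λ ()
... | false | true  = contradiction (trans (≡-sym ([]=⇒lookup (q⇒p (lookup⇒[]= w q eqq)))) eqp) λ ()

∣p-x∣≤k : ∀ {n k} {p : Subset n} {x} → x ∈ p → ∣ p ∣ ≤ suc k → ∣ p - x ∣ ≤ k
∣p-x∣≤k x∈p ∣p∣≤1+k = ≤-pred (<-≤-trans (x∈p⇒∣p-x∣<∣p∣ x∈p) ∣p∣≤1+k)

module _ {n} (G : Graph n) where

  -- Domination is decidable; this lets us search constructively for a redundant vertex.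
  dominating? : (S : Subset n) → Dec (Dominating G S)
  dominating? S =
    all? λ v → (v ∈? S) ⊎-dec any? (λ u → (u ∈? S) ×-dec (adj G u v Bool.≟ true))

  dominating-⊆ : ∀ {T X} → T ⊆ X → Dominating G T → Dominating G X
  dominating-⊆ T⊆X domT v with domT v
  ... | inj₁ v∈T             = inj₁ (T⊆X v∈T)
  ... | inj₂ (u , u∈T , uv) = inj₂ (u , T⊆X u∈T , uv)

  -- Minimality needs only be checked on single-vertex deletions: a proper
  -- subset T ⊂ X omits some x ∈ X, so T ⊆ X - x and X - x would dominate.
  irredundant⇒minimal : ∀ {X} → Dominating G X →
                        (∀ x → x ∈ X → ¬ Dominating G (X - x)) → MinimalDominating G X
  irredundant⇒minimal {X} domX irredundant = domX , not-dominating
    where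
    not-dominating : ∀ T → T ⊂ X → ¬ Dominating G T
    not-dominating T (T⊆X , x , x∈X , x∉T) domT =
      irredundant x x∈X (dominating-⊆ T⊆X-x domT)
      where
      T⊆X-x : T ⊆ X - x
      T⊆X-x y∈T = x∈p∧x≢y⇒x∈p-y (T⊆X y∈T) λ { refl → x∉T y∈T }

  redundant-vertex : ∀ {X} → Dominating G X → ¬ MinimalDominating G X →
                     ∃ λ v → v ∈ X × Dominating G (X - v)
  redundant-vertex {X} domX ¬minX with any? (λ v → (v ∈? X) ×-dec dominating? (X - v))
  ... | yes redundant = redundant
  ... | no  none      = contradiction
                          (irredundant⇒minimal domX λ x x∈X domX-x → none (x , x∈X , domX-x))
                          ¬minX

  removal-diff : ∀ {X v} → v ∈ X → DiffByOne G X (X - v)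
  removal-diff {X} {v} v∈X = v , differs-at-v , agrees-elsewhere
    where
    differs-at-v : lookup X v ≢ lookup (X - v) v
    differs-at-v e = x∉p-x X v (lookup⇒[]= v (X - v) (trans (≡-sym e) ([]=⇒lookup v∈X)))
    agrees-elsewhere : ∀ w → w ≢ v → lookup X w ≡ lookup (X - v) w
    agrees-elsewhere w w≢v =
      lookup-≡ X (X - v) w (λ w∈X → x∈p∧x≢y⇒x∈p-y w∈X w≢v) (p─q⊆p X ⁅ v ⁆)

  DiffByOne-sym : ∀ {A B} → DiffByOne G A B → DiffByOne G B A
  DiffByOne-sym (v , differ , agree) = v , (λ e → differ (≡-sym e)) , λ w w≢v → ≡-sym (agree w w≢v)

  InD-suc : ∀ {k A} → InD G k A → InD G (suc k) A
  InD-suc (domA , ∣A∣≤k) = domA , m≤n⇒m≤1+n ∣A∣≤k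

  lift : ∀ {k A B} → Walk G k A B → Walk G (suc k) A B
  lift done                 = done
  lift (step inB diff walk) = step (InD-suc inB) diff (lift walk)

  _++_ : ∀ {k A B C} → Walk G k A B → Walk G k B C → Walk G k A C
  done                 ++ walk′ = walk′
  step inB diff walk   ++ walk′ = step inB diff (walk ++ walk′)

  -- If ∣X∣ = k + 1 > Γ(G),
  -- X is not minimal, and deleting a redundant vertex gives the neighbour.
  descend : ∀ {Γ k X} → IsUpperDomination G Γ → Γ < k → InD G (suc k) X →
            ∃ λ Y → InD G k Y × Walk G (suc k) X Y × Walk G (suc k) Y X
  descend {k = k} {X} (_ , minimal≤Γ) Γ<k inX@(domX , ∣X∣≤1+k) with ∣ X ∣ ≤? k
  ... | yes ∣X∣≤k = X , (domX , ∣X∣≤k) , done , done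
  ... | no  ∣X∣≰k =
    X - v , inX-v , step (InD-suc inX-v) diff done , step inX (DiffByOne-sym {X} {X - v} diff) done
    where
    notMinimal : ¬ MinimalDominating G X
    notMinimal minX = <⇒≱ (<-trans Γ<k (≰⇒> ∣X∣≰k)) (minimal≤Γ X minX)
    redundant : ∃ λ v → v ∈ X × Dominating G (X - v)
    redundant = redundant-vertex domX notMinimal
    v : Fin n
    v = proj₁ redundant
    v∈X : v ∈ X
    v∈X = proj₁ (proj₂ redundant)
    inX-v : InD G k (X - v)
    inX-v = proj₂ (proj₂ redundant) , ∣p-x∣≤k v∈X ∣X∣≤1+k
    diff : DiffByOne G X (X - v)
    diff = removal-diff v∈X

lemma4 : ∀ {n} (G : Graph n) (Γ k : ℕ) → IsUpperDomination G Γ → Γ < k →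
           Connected-D G k → Connected-D G (suc k)
lemma4 G Γ k upper Γ<k connected A B inA inB
  with descend G upper Γ<k inA | descend G upper Γ<k inB
... | A′ , inA′ , A→A′ , _ | B′ , inB′ , _ , B′→B =
  _++_ G A→A′ (_++_ G (lift G (connected A′ B′ inA′ inB′)) B′→B)
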